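{- For every natural number $k$, $M(k,2)=\left\lfloor\frac{3(k-1)}{2}\right\rfloor$. Furthermore, there is a $(k,2)$-perfect set that percolates $[k]\times[2]$ in time $M(k,2)$.
   Context: Work in $2$-neighbour bootstrap percolation: given a graph and $A_0=A$ a set of initially infected vertices, $A_t=A_{t-1}\cup\{v: v\text{ has at least 2 neighbours in }A_{t-1}\}$; $A$ percolates if eventually every vertex is infected, and its percolation time is the least $T$ with $A_T$ equal to the whole vertex set. For $k,\ell\in\mathbb N$, $M(k,\ell)$ is the maximum percolation time of a set percolating the grid $[k]\times[\ell]$ (sites adjacent iff at $\ell_1$-distance 1). $\mathrm{Rec}(k,\ell)$ denotes the set of all rectangles $\{a,\dots,a+k-1\}\times\{b,\dots,b+\ell-1\}\subseteq\mathbb Z^2$; for $R$ in it, $M(R):=M(k,\ell)$. A rectangle $R$ is internally spanned by $A$ if the process run on the grid graph induced by $R$ starting from $A\cap R$ infects all of $R$. Distances between sites are $\ell_1$ (graph) distances; the distance between sets is the minimum distance between their elements. A set $A\subseteq \mathbb Z^2$ is $(k,\ell)$-perfect if there is a nested sequence of rectangles $P_0\subset P_1\subset\dots\subset P_r$ with $P_i\in\mathrm{Rec}(s_i,t_i)$ and $P_r\in\mathrm{Rec}(k,\ell)$ such that: (a) $s_0\le2$ or $t_0\le2$ or $s_0=t_0=3$; and (if $r\ge1$) $s_1,t_1\ge3$ with $(s_1,t_1)\ne(3,3)$; (b) for each $1\le i\le r$, $(s_i,t_i)$ is one of $(s_{i-1}+1,t_{i-1}+1)$, $(s_{i-1}+2,t_{i-1})$,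 $(s_{i-1},t_{i-1}+2)$, $(s_{i-1}+2,t_{i-1}+1)$, $(s_{i-1}+1,t_{i-1}+2)$, $(s_{i-1},t_{i-1}+3)$, $(s_{i-1}+3,t_{i-1})$; (c) for every $0\le i\le r$, $P_i$ is internally spanned by $A\cap P_i$ in time exactly $M(P_i)$; (d) for every $0\le i\le r$, if $P_i$ has no side of length 1 then among the sites of $P_i$ infected last (in the process restricted to $P_i$ from $A\cap P_i$) there is a corner site of $P_i$; (e) for every $1\le i\le r$ with $(s_i,t_i)$ one of the first three options in (b), there is a site $v_{i-1}\in A$ such that $P_{i-1}\cup\{v_{i-1}\}$ internally spans $P_i$ and $v_{i-1}$ is at distance exactly 2 from a corner site of $P_{i-1}$ (one that becomes infected last in $P_{i-1}$, if there is such) and at distance at least 3 from every other site of $P_{i-1}$; (f) for every $1\le i\le r$ with $(s_i,t_i)$ one of the last four options in (b), there are sites $v_{i-1},w_{i-1}\in A$ such that $P_{i-1}\cup\{v_{i-1},w_{i-1}\}$ internally spans $P_i$, $v_{i-1}$ is at distance exactly 2 from a corner site of $P_{i-1}$ (one that becomes infected last in $P_{i-1}$, if there is such) and at distance at least 3 from every other site of $P_{i-1}$, while $w_{i-1}$ is at distance exactly 1 from one of the last corner sites to become infected in the closure of $P_{i-1}\cup\{v_{i-1}\}$ (the set of all eventually infected sites) and at distance at least 2 from every other site of that closure. -}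

module Defs where

open import Data.Bool using (Bool; true; false; _∧_; _∨_; if_then_else_)
open import Data.Nat as ℕ using (ℕ; zero; suc; _≤_; _<_; _≤ᵇ_; _∸_; _*_; _/_)
open import Data.Integer as ℤ using (ℤ; +_; ∣_∣)
open import Data.Product using (Σ; _×_; _,_; proj₁; proj₂)
open import Data.Sum using (_⊎_)
open import Relation.Binary.PropositionalEquality using (_≡_; _≢_)
open import Relation.Nullary using (¬_; does)
open import Function.Bundles using (_⇔_)

Site : Set
Site = ℤ × ℤ

dist : Site → Site → ℕ
dist (a , b) (c , d) = ∣ a ℤ.- c ∣ ℕ.+ ∣ b ℤ.- d ∣

eqSite : Site → Site → Bool
eqSite (a , b) (c , d) = does (a ℤ.≟ c) ∧ does (b ℤ.≟ d)

SiteSet : Set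
SiteSet = Site → Bool

-- rect x y w h = {x,…,x+w-1} × {y,…,y+h-1} ∈ Rec(w,h)
record Rect : Set where
  constructor rect
  field
    x y : ℤ
    w h : ℕ
open Rect public

inRect : Rect → SiteSet
inRect (rect x y w h) (u , v) =
  (x ℤ.≤ᵇ u) ∧ (u ℤ.+ ℤ.1ℤ ℤ.≤ᵇ x ℤ.+ + w) ∧ (y ℤ.≤ᵇ v) ∧ (v ℤ.+ ℤ.1ℤ ℤ.≤ᵇ y ℤ.+ + h)

grid : ℕ → ℕ → Rect
grid k ℓ = rect (+ 1) (+ 1) k ℓ

Corner : Rect → Site → Set
Corner (rect x y w h) c =
  (c ≡ (x , y)) ⊎ (c ≡ (x ℤ.+ + (w ∸ 1) , y)) ⊎
  (c ≡ (x , y ℤ.+ + (h ∸ 1))) ⊎ (c ≡ (x ℤ.+ + (w ∸ 1) , y ℤ.+ + (h ∸ 1)))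

_⊆R_ : Rect → Rect → Set
P ⊆R Q = ∀ u → inRect P u ≡ true → inRect Q u ≡ true

-- 2-neighbour bootstrap percolation on the graph induced by a vertex
-- set U ⊆ ℤ² (U = a rectangle, or U = all of ℤ²), started from A ∩ U.

b2n : Bool → ℕ
b2n true  = 1
b2n false = 0

plane : SiteSet
plane _ = true

infected : SiteSet → SiteSet → ℕ → SiteSet
infected U A zero v = U v ∧ A v
infected U A (suc t) (a , b) =
  U (a , b) ∧
  (infected U A t (a , b) ∨
   (2 ≤ᵇ (b2n (U (a ℤ.+ ℤ.1ℤ , b) ∧ infected U A t (a ℤ.+ ℤ.1ℤ , b))
          ℕ.+ b2n (U (a ℤ.- ℤ.1ℤ , b) ∧ infected U A t (a ℤ.- ℤ.1ℤ , b))
          ℕ.+ b2n (U (a , b ℤ.+ ℤ.1ℤ) ∧ infected U A t (a , b ℤ.+ ℤ.1ℤ))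
          ℕ.+ b2n (U (a , b ℤ.- ℤ.1ℤ) ∧ infected U A t (a , b ℤ.- ℤ.1ℤ)))))

Full : Rect → SiteSet → ℕ → Set
Full R A t = ∀ u → inRect R u ≡ true → infected (inRect R) A t u ≡ true

Spans : Rect → SiteSet → Set
Spans R A = Σ ℕ λ t → Full R A t

SpansInTime : Rect → SiteSet → ℕ → Set
SpansInTime R A T = Full R A T × (∀ t → t < T → ¬ Full R A t)

InfAt : SiteSet → SiteSet → Site → ℕ → Set
InfAt U A v t = infected U A t v ≡ true × (∀ t' → t' < t → infected U A t' v ≡ false)

LastInf : Rect → SiteSet → Site → Set
LastInf R A v = Σ ℕ λ T → SpansInTime R A T × InfAt (inRect R) A v T

-- IsM k ℓ m  :⇔  M(k,ℓ) = m, i.e. m is the maximum percolation time of a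
-- set percolating the grid [k] × [ℓ]
IsM : ℕ → ℕ → ℕ → Set
IsM k ℓ m = (Σ SiteSet λ A → SpansInTime (grid k ℓ) A m)
          × (∀ A T → SpansInTime (grid k ℓ) A T → T ≤ m)

-- the seven growth options of condition (b), in the order listed
data Move : Set where
  d11 d20 d02 d21 d12 d03 d30 : Move

grow : Move → ℕ → ℕ → ℕ × ℕ
grow d11 s t = suc s , suc t
grow d20 s t = suc (suc s) , t
grow d02 s t = s , suc (suc t)
grow d21 s t = suc (suc s) , suc t
grow d12 s t = suc s , suc (suc t)
grow d03 s t = s , suc (suc (suc t))
grow d30 s t = suc (suc (suc s)) , t

addSite : SiteSet → Site → SiteSet
addSite S v u = S u ∨ eqSite u v

-- condition on v_{i-1} common to (e) and (f): v ∈ A, at distance exactly 2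
-- from a corner c of P (a last-infected one if some corner is infected last)
-- and at distance ≥ 3 from every other site of P
GoodV : SiteSet → Rect → Site → Set
GoodV A P v =
  A v ≡ true ×
  (Σ Site λ c → Corner P c × dist v c ≡ 2 ×
     (∀ u → inRect P u ≡ true → u ≢ c → 3 ≤ dist v u) ×
     ((Σ Site λ c' → Corner P c' × LastInf P A c') → LastInf P A c))

CondE : SiteSet → Rect → Rect → Set
CondE A P P' = Σ Site λ v → GoodV A P v × Spans P' (addSite (inRect P) v)

-- The closure of P ∪ {v} (all sites
-- eventually infected in ℤ²) is a rectangle Q; w ∈ A is at distance 1 from a
-- corner c of Q whose infection time is maximal among the corners of Q, and at
-- distance ≥ 2 from every other site of the closure.
CondF : SiteSet → Rect → Rect → Set
CondF A P P' = Σ Site λ v → Σ Site λ w →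
  GoodV A P v ×
  Spans P' (addSite (addSite (inRect P) v) w) ×
  A w ≡ true ×
  (Σ Rect λ Q →
     (∀ u → (Σ ℕ λ t → infected plane (addSite (inRect P) v) t u ≡ true)
            ⇔ (inRect Q u ≡ true)) ×
     (Σ Site λ c → Σ ℕ λ tc →
        Corner Q c × InfAt plane (addSite (inRect P) v) c tc ×
        (∀ c' t' → Corner Q c' → InfAt plane (addSite (inRect P) v) c' t' → t' ≤ tc) ×
        dist w c ≡ 1 ×
        (∀ u → inRect Q u ≡ true → u ≢ c → 2 ≤ dist w u)))

CondEF : Move → SiteSet → Rect → Rect → Set
CondEF d11 = CondE
CondEF d20 = CondE
CondEF d02 = CondE
CondEF d21 = CondF
CondEF d12 = CondF
CondEF d03 = CondF
CondEF d30 = CondF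

CondA0 : ℕ → ℕ → Set
CondA0 s t = (s ≤ 2) ⊎ (t ≤ 2) ⊎ (s ≡ 3 × t ≡ 3)

CondA1 : ℕ → ℕ → Set
CondA1 s t = 3 ≤ s × 3 ≤ t × ¬ (s ≡ 3 × t ≡ 3)

Perfect : ℕ → ℕ → SiteSet → Set
Perfect k ℓ A = Σ ℕ λ r → Σ (ℕ → Rect) λ P →
  (w (P r) ≡ k × h (P r) ≡ ℓ) ×
  (1 ≤ w (P 0) × 1 ≤ h (P 0)) ×
  CondA0 (w (P 0)) (h (P 0)) ×
  (1 ≤ r → CondA1 (w (P 1)) (h (P 1))) ×
  (∀ j → j < r →
     P j ⊆R P (suc j) ×
     (Σ Move λ m → (w (P (suc j)) , h (P (suc j))) ≡ grow m (w (P j)) (h (P j))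
                   × CondEF m A (P j) (P (suc j)))) ×
  (∀ i → i ≤ r →
     (Σ ℕ λ m → IsM (w (P i)) (h (P i)) m × SpansInTime (P i) A m) ×
     (2 ≤ w (P i) → 2 ≤ h (P i) → Σ Site λ c → Corner (P i) c × LastInf (P i) A c))

-- In a percolating set, column 1, column k and one of any two adjacent columns
-- are occupied, because an empty column next to an empty (or missing) column stays empty; and
-- some 2 × 2 square contains two initial sites not side by side in a row (a seed), because
-- seed-free configurations stay seed-free. From a seed the columns fill up one by one: a full
-- column fills an adjacent occupied column in one step, and the column beyond an empty one in
-- three, so the grid is infected by time ⌊3(k − 1)/2⌋. Fill column 1 and put one site in each of columns 3, 5, 7, … and in column k,
-- the rows alternating every two columns. A potential vanishing on the initial sites and growing
-- by at most one along all edges but one at every site bounds the infection times from below;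
-- at a corner of column k it equals ⌊3(k − 1)/2⌋.
module Submission where

open import Defs
open import Data.Bool using (Bool; true; false; _∧_; _∨_; not; if_then_else_)
open import Data.Bool.Properties using (∨-zeroʳ; ∧-identityʳ; ∧-conicalˡ; ∧-conicalʳ; ¬-not; T-≡)
open import Function.Bundles using (Equivalence)
open import Data.Nat using (ℕ; zero; suc; _≤_; _<_; _*_; _∸_; _/_; _≤ᵇ_; _≡ᵇ_; z≤n; s≤s)
import Data.Nat as ℕ
open import Data.Nat.Properties as ℕₚ using (≤-refl; ≤-trans; ≤-reflexive; <⇒≤; n≤1+n; m≤n+m)
open import Data.Nat.DivMod using (m/n≡1+[m∸n]/n)
open import Data.Integer as ℤ using (+_; -[1+_])
open import Data.Product using (Σ; _×_; _,_; proj₁; proj₂)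
open import Data.Sum using (_⊎_; inj₁; inj₂; map₂)
open import Data.Empty using (⊥; ⊥-elim)
open import Relation.Binary.PropositionalEquality
  using (_≡_; _≢_; refl; sym; trans; cong; cong₂; subst; module ≡-Reasoning)
open import Relation.Nullary using (¬_; yes; no)
open import Function using (_∘_)

-- One step per column, or three steps for two columns when the first is initially empty.
crossTime : ℕ → ℕ
crossTime zero = 0
crossTime (suc zero) = 1
crossTime (suc (suc d)) = 3 ℕ.+ crossTime d

crossTime-<-suc : ∀ d → crossTime d < crossTime (suc d)
crossTime-<-suc zero = s≤s z≤n
crossTime-<-suc (suc zero) = s≤s (s≤s z≤n)
crossTime-<-suc (suc (suc d)) = s≤s (s≤s (s≤s (crossTime-<-suc d)))

crossTime-+1 : ∀ d → crossTime d ℕ.+ 1 ≤ crossTime (suc d)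
crossTime-+1 d = ≤-trans (≤-reflexive (ℕₚ.+-comm (crossTime d) 1)) (crossTime-<-suc d)

crossTime-mono : ∀ {d d′} → d ≤ d′ → crossTime d ≤ crossTime d′
crossTime-mono d≤d′ = go (ℕₚ.≤⇒≤′ d≤d′)
  where
  go : ∀ {d d′} → d ℕ.≤′ d′ → crossTime d ≤ crossTime d′
  go ℕ.≤′-refl = ≤-refl
  go {d′ = suc d′} (ℕ.≤′-step d≤′d′) = ≤-trans (go d≤′d′) (<⇒≤ (crossTime-<-suc d′))

crossTime≡⌊3d/2⌋ : ∀ d → crossTime d ≡ (3 * d) / 2
crossTime≡⌊3d/2⌋ zero = refl
crossTime≡⌊3d/2⌋ (suc zero) = refl
crossTime≡⌊3d/2⌋ (suc (suc d)) = sym (begin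
  3 * suc (suc d) / 2
    ≡⟨ cong (_/ 2) (trans (ℕₚ.*-suc 3 (suc d)) (cong (3 ℕ.+_) (ℕₚ.*-suc 3 d))) ⟩
  (2 ℕ.+ (2 ℕ.+ (2 ℕ.+ 3 * d))) / 2  ≡⟨ 2+x/2 (2 ℕ.+ (2 ℕ.+ 3 * d)) ⟩
  suc ((2 ℕ.+ (2 ℕ.+ 3 * d)) / 2)    ≡⟨ cong suc (2+x/2 (2 ℕ.+ 3 * d)) ⟩
  2 ℕ.+ (2 ℕ.+ 3 * d) / 2            ≡⟨ cong (2 ℕ.+_) (2+x/2 (3 * d)) ⟩
  3 ℕ.+ 3 * d / 2                    ≡⟨ cong (3 ℕ.+_) (sym (crossTime≡⌊3d/2⌋ d)) ⟩
  3 ℕ.+ crossTime d                  ∎)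
  where
  open ≡-Reasoning
  2+x/2 : ∀ x → (2 ℕ.+ x) / 2 ≡ suc (x / 2)
  2+x/2 x = m/n≡1+[m∸n]/n {2 ℕ.+ x} (s≤s (s≤s z≤n))

trueFalse-elim : ∀ {A : Set} {x} → x ≡ true → x ≡ false → A
trueFalse-elim refl ()

bool-cases : ∀ {A : Set} b → (b ≡ true → A) → (b ≡ false → A) → A
bool-cases true onTrue onFalse = onTrue refl
bool-cases false onTrue onFalse = onFalse refl

not-swap : ∀ {x y} → x ≡ not y → y ≡ not x
not-swap {false} {true} refl = refl
not-swap {true} {false} refl = refl

data Dir : Set where
  right left up down : Dir

atLeastTwo : (Dir → Bool) → Bool
atLeastTwo f = 2 ≤ᵇ b2n (f right) ℕ.+ b2n (f left) ℕ.+ b2n (f up) ℕ.+ b2n (f down)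

TwoOf : (Dir → Set) → Set
TwoOf P = Σ Dir λ x → Σ Dir λ y → x ≢ y × P x × P y

atLeastTwo⇒TwoOf : ∀ f → atLeastTwo f ≡ true → TwoOf (λ d → f d ≡ true)
atLeastTwo⇒TwoOf f two with f right in fr | f left in fl | f up in fu | f down in fd
... | true | true | _ | _ = right , left , (λ ()) , fr , fl
... | true | false | true | _ = right , up , (λ ()) , fr , fu
... | true | false | false | true = right , down , (λ ()) , fr , fd
... | false | true | true | _ = left , up , (λ ()) , fl , fu
... | false | true | false | true = left , down , (λ ()) , fl , fd
... | false | false | true | true = up , down , (λ ()) , fu , fd
atLeastTwo⇒TwoOf f () | true | false | false | false
atLeastTwo⇒TwoOf f () | false | true | false | false
atLeastTwo⇒TwoOf f () | false | false | true | false
atLeastTwo⇒TwoOf f () | false | false | false | true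
atLeastTwo⇒TwoOf f () | false | false | false | false

atLeastTwo-right-left : ∀ f → f right ≡ true → f left ≡ true → atLeastTwo f ≡ true
atLeastTwo-right-left f p q rewrite p | q = refl

atLeastTwo-right-up : ∀ f → f right ≡ true → f up ≡ true → atLeastTwo f ≡ true
atLeastTwo-right-up f p q rewrite p | q with f left
... | true = refl
... | false = refl

atLeastTwo-right-down : ∀ f → f right ≡ true → f down ≡ true → atLeastTwo f ≡ true
atLeastTwo-right-down f p q rewrite p | q with f left | f up
... | true | _ = refl
... | false | true = refl
... | false | false = refl

atLeastTwo-left-up : ∀ f → f left ≡ true → f up ≡ true → atLeastTwo f ≡ true
atLeastTwo-left-up f p q rewrite p | q with f right
... | true = refl
... | false = refl

atLeastTwo-left-down : ∀ f → f left ≡ true → f down ≡ true → atLeastTwo f ≡ true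
atLeastTwo-left-down f p q rewrite p | q with f right | f up
... | true | _ = refl
... | false | true = refl
... | false | false = refl

infected⇒inside : ∀ U A t v → infected U A t v ≡ true → U v ≡ true
infected⇒inside U A zero v infected with U v
... | true = refl
... | false = infected
infected⇒inside U A (suc t) (a , b) infected with U (a , b)
... | true = refl
... | false = infected

inside-∧-infected : ∀ U A t v → U v ∧ infected U A t v ≡ infected U A t v
inside-∧-infected U A t v with infected U A t v in eq
... | true = cong (_∧ true) (infected⇒inside U A t v eq)
... | false with U v
...   | true = refl
...   | false = refl

module TwoRowGrid (k : ℕ) (A : SiteSet) where

  inGrid : SiteSet
  inGrid = inRect (grid k 2)

  inf : ℕ → ℕ → ℕ → Bool
  inf t i r = infected inGrid A t (+ i , + r)

  record InGrid (i r : ℕ) : Set where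
    constructor inGrid⁺
    field
      1≤i : 1 ≤ i
      i≤k : i ≤ k
      1≤r : 1 ≤ r
      r≤2 : r ≤ 2
  open InGrid public

  private
    ≤ᵇ⇒≤ : ∀ {m n} → (m ≤ᵇ n) ≡ true → m ≤ n
    ≤ᵇ⇒≤ {m} {n} p = ℕₚ.≤ᵇ⇒≤ m n (Equivalence.from T-≡ p)

    ≤⇒≤ᵇ : ∀ {m n} → m ≤ n → (m ≤ᵇ n) ≡ true
    ≤⇒≤ᵇ m≤n = Equivalence.to T-≡ (ℕₚ.≤⇒≤ᵇ m≤n)

    suc≤⇒+1≤ : ∀ {m n} → suc m ≤ n → m ℕ.+ 1 ≤ n
    suc≤⇒+1≤ {m} {n} = subst (_≤ n) (ℕₚ.+-comm 1 m)

    +1≡suc : ∀ n → + n ℤ.+ ℤ.1ℤ ≡ + suc n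
    +1≡suc n = cong +_ (ℕₚ.+-comm n 1)

  ¬InGrid-column0 : ∀ {r} → ¬ InGrid 0 r
  ¬InGrid-column0 = ℕₚ.n≮0 ∘ 1≤i

  ¬InGrid-row0 : ∀ {i} → ¬ InGrid i 0
  ¬InGrid-row0 = ℕₚ.n≮0 ∘ 1≤r

  ¬InGrid-row≥3 : ∀ {i r} → ¬ InGrid i (3 ℕ.+ r)
  ¬InGrid-row≥3 g with r≤2 g
  ... | s≤s (s≤s ())

  inGrid⇒InGrid : ∀ i r → inGrid (+ i , + r) ≡ true → InGrid i r
  inGrid⇒InGrid i r p = inGrid⁺
    (≤ᵇ⇒≤ (∧-conicalˡ _ _ p))
    (ℕₚ.≤-pred (subst (_≤ suc k) (ℕₚ.+-comm i 1) (≤ᵇ⇒≤ (∧-conicalˡ _ _ p₂₃₄))))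
    (≤ᵇ⇒≤ (∧-conicalˡ _ _ p₃₄))
    (ℕₚ.≤-pred (subst (_≤ 3) (ℕₚ.+-comm r 1) (≤ᵇ⇒≤ (∧-conicalʳ (1 ≤ᵇ r) _ p₃₄))))
    where
    p₂₃₄ = ∧-conicalʳ (1 ≤ᵇ i) _ p
    p₃₄ = ∧-conicalʳ (i ℕ.+ 1 ≤ᵇ suc k) _ p₂₃₄

  InGrid⇒inGrid : ∀ {i r} → InGrid i r → inGrid (+ i , + r) ≡ true
  InGrid⇒inGrid (inGrid⁺ 1≤i i≤k 1≤r r≤2)
    rewrite ≤⇒≤ᵇ 1≤i | ≤⇒≤ᵇ 1≤r | ≤⇒≤ᵇ (suc≤⇒+1≤ (s≤s i≤k)) | ≤⇒≤ᵇ (suc≤⇒+1≤ (s≤s r≤2))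
    = refl

  inf⇒InGrid : ∀ t i r → inf t i r ≡ true → InGrid i r
  inf⇒InGrid t i r p = inGrid⇒InGrid i r (infected⇒inside inGrid A t (+ i , + r) p)

  inf-suc : ∀ t i r → inf t i r ≡ true → inf (suc t) i r ≡ true
  inf-suc t i r p rewrite infected⇒inside inGrid A t (+ i , + r) p | p = refl

  inf-mono : ∀ {t t′} i r → t ≤ t′ → inf t i r ≡ true → inf t′ i r ≡ true
  inf-mono i r t≤t′ p = go (ℕₚ.≤⇒≤′ t≤t′)
    where
    go : ∀ {t′} → _ ℕ.≤′ t′ → inf t′ i r ≡ true
    go ℕ.≤′-refl = p
    go {suc t′} (ℕ.≤′-step t≤′t′) = inf-suc t′ i r (go t≤′t′)

  uninfected-outside : ∀ t i r → ¬ InGrid i r → inf t i r ≡ false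
  uninfected-outside t i r ∉grid = ¬-not (λ p → ∉grid (inf⇒InGrid t i r p))

  uninfected-column0 : ∀ t r → inf t 0 r ≡ false
  uninfected-column0 t r = uninfected-outside t 0 r ¬InGrid-column0

  uninfected-row0 : ∀ t i → inf t i 0 ≡ false
  uninfected-row0 t i = uninfected-outside t i 0 ¬InGrid-row0

  uninfected-row3 : ∀ t i → inf t i 3 ≡ false
  uninfected-row3 t i = uninfected-outside t i 3 ¬InGrid-row≥3

  -- The neighbour in direction d of the site (1 + i , 1 + r).
  nbCol : Dir → ℕ → ℕ
  nbCol right i = suc (suc i)
  nbCol left i = i
  nbCol up i = suc i
  nbCol down i = suc i

  nbRow : Dir → ℕ → ℕ
  nbRow right r = suc r
  nbRow left r = suc r
  nbRow up r = suc (suc r)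
  nbRow down r = r

  nbInf : ℕ → ℕ → ℕ → Dir → Bool
  nbInf t i r d = inf t (nbCol d i) (nbRow d r)

  InfectedNb : ℕ → ℕ → ℕ → Dir → Set
  InfectedNb t i r d = nbInf t i r d ≡ true

  inf-suc-suc : ∀ t i r → inf (suc t) (suc i) (suc r) ≡
    inGrid (+ suc i , + suc r) ∧ (inf t (suc i) (suc r) ∨ atLeastTwo (nbInf t i r))
  inf-suc-suc t i r
    rewrite inside-∧-infected inGrid A t (+ suc i ℤ.+ ℤ.1ℤ , + suc r)
          | inside-∧-infected inGrid A t (+ suc i ℤ.- ℤ.1ℤ , + suc r)
          | inside-∧-infected inGrid A t (+ suc i , + suc r ℤ.+ ℤ.1ℤ)
          | inside-∧-infected inGrid A t (+ suc i , + suc r ℤ.- ℤ.1ℤ)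
          | +1≡suc (suc i) | +1≡suc (suc r) = refl

  becomesInfected : ∀ t i r → InGrid (suc i) (suc r) → atLeastTwo (nbInf t i r) ≡ true →
    inf (suc t) (suc i) (suc r) ≡ true
  becomesInfected t i r g two rewrite inf-suc-suc t i r | InGrid⇒inGrid g | two = ∨-zeroʳ _

  newlyInfected⇒TwoOf : ∀ t i r → inf (suc t) (suc i) (suc r) ≡ true → inf t (suc i) (suc r) ≡ false →
    TwoOf (InfectedNb t i r)
  newlyInfected⇒TwoOf t i r now before =
    atLeastTwo⇒TwoOf (nbInf t i r) (twoInfected (trans (sym (inf-suc-suc t i r)) now))
    where
    twoInfected : ∀ {g a} → g ∧ (inf t (suc i) (suc r) ∨ a) ≡ true → a ≡ true
    twoInfected {true} p rewrite before = p

  staysUninfected : ∀ t i r (d₀ : Dir) → inf t (suc i) (suc r) ≡ false →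
    (∀ d → InfectedNb t i r d → d ≡ d₀) → inf (suc t) (suc i) (suc r) ≡ false
  staysUninfected t i r d₀ before onlyD₀ with inf (suc t) (suc i) (suc r) in now
  ... | false = refl
  ... | true with newlyInfected⇒TwoOf t i r now before
  ...   | x , y , x≢y , px , py = ⊥-elim (x≢y (trans (onlyD₀ x px) (sym (onlyD₀ y py))))

  data Adjacent : ℕ → ℕ → Set where
    toRight : ∀ i → Adjacent i (suc i)
    toLeft : ∀ i → Adjacent (suc i) i

  data Opposite : ℕ → ℕ → Set where
    lower : Opposite 1 2
    upper : Opposite 2 1

  infect-between : ∀ t i r → inf t i (suc r) ≡ true → inf t (suc (suc i)) (suc r) ≡ true →
    inf (suc t) (suc i) (suc r) ≡ true
  infect-between t i r p q =
    becomesInfected t i r (inGrid⁺ (s≤s z≤n) (<⇒≤ (i≤k g)) (1≤r g) (r≤2 g))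
      (atLeastTwo-right-left (nbInf t i r) q p)
    where g = inf⇒InGrid t (suc (suc i)) (suc r) q

  infect-corner : ∀ t {i i′ r r′} → Adjacent i i′ → Opposite r r′ →
    inf t i r ≡ true → inf t i′ r′ ≡ true → inf (suc t) i′ r ≡ true
  infect-corner t (toRight i) lower p q =
    becomesInfected t i 0 (inGrid⁺ (1≤i g) (i≤k g) ≤-refl (s≤s z≤n))
      (atLeastTwo-left-up (nbInf t i 0) p q)
    where g = inf⇒InGrid t (suc i) 2 q
  infect-corner t (toRight i) upper p q =
    becomesInfected t i 1 (inGrid⁺ (1≤i g) (i≤k g) (s≤s z≤n) ≤-refl)
      (atLeastTwo-left-down (nbInf t i 1) p q)
    where g = inf⇒InGrid t (suc i) 1 q
  infect-corner t (toLeft zero) _ _ q = ⊥-elim (¬InGrid-column0 (inf⇒InGrid t 0 _ q))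
  infect-corner t (toLeft (suc i)) lower p q =
    becomesInfected t i 0 (inGrid⁺ (1≤i g) (i≤k g) ≤-refl (s≤s z≤n))
      (atLeastTwo-right-up (nbInf t i 0) p q)
    where g = inf⇒InGrid t (suc i) 2 q
  infect-corner t (toLeft (suc i)) upper p q =
    becomesInfected t i 1 (inGrid⁺ (1≤i g) (i≤k g) (s≤s z≤n) ≤-refl)
      (atLeastTwo-right-down (nbInf t i 1) p q)
    where g = inf⇒InGrid t (suc i) 1 q

  record ColumnFull (t i : ℕ) : Set where
    constructor _&_
    field
      lowerInf : inf t i 1 ≡ true
      upperInf : inf t i 2 ≡ true
  open ColumnFull

  data Occupied (t i : ℕ) : Set where
    lowerOcc : inf t i 1 ≡ true → Occupied t i
    upperOcc : inf t i 2 ≡ true → Occupied t i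

  ColumnFull-mono : ∀ {t t′ i} → t ≤ t′ → ColumnFull t i → ColumnFull t′ i
  ColumnFull-mono {i = i} t≤t′ (p & q) = inf-mono i 1 t≤t′ p & inf-mono i 2 t≤t′ q

  Occupied-mono : ∀ {t t′ i} → t ≤ t′ → Occupied t i → Occupied t′ i
  Occupied-mono {i = i} t≤t′ (lowerOcc p) = lowerOcc (inf-mono i 1 t≤t′ p)
  Occupied-mono {i = i} t≤t′ (upperOcc p) = upperOcc (inf-mono i 2 t≤t′ p)

  fill-adjacent : ∀ {t i i′} → Adjacent i i′ → ColumnFull t i → Occupied t i′ → ColumnFull (suc t) i′
  fill-adjacent {t} adj (p & q) (lowerOcc p′) = inf-suc t _ 1 p′ & infect-corner t adj upper q p′
  fill-adjacent {t} adj (p & q) (upperOcc q′) = infect-corner t adj lower p q′ & inf-suc t _ 2 q′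

  data Heading : Set where
    rightward leftward : Heading

  Next : Heading → ℕ → ℕ → Set
  Next rightward i i′ = i′ ≡ suc i
  Next leftward i i′ = i ≡ suc i′

  Next⇒Adjacent : ∀ h {i i′} → Next h i i′ → Adjacent i i′
  Next⇒Adjacent rightward refl = toRight _
  Next⇒Adjacent leftward refl = toLeft _

  infect-between-Next : ∀ h t {i i′ i″} r → Next h i i′ → Next h i′ i″ →
    inf t i (suc r) ≡ true → inf t i″ (suc r) ≡ true → inf (suc t) i′ (suc r) ≡ true
  infect-between-Next rightward t r refl refl p q = infect-between t _ r p q
  infect-between-Next leftward t r refl refl p q = infect-between t _ r q p

  -- The middle column is bridged in the row of the occupied site, then filled.
  fill-across : ∀ h {t i i′ i″} → Next h i i′ → Next h i′ i″ → ColumnFull t i → Occupied t i″ →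
    ColumnFull (2 ℕ.+ t) i′ × ColumnFull (3 ℕ.+ t) i″
  fill-across h {t} {i} {i′} {i″} next next′ F occ =
    middle occ , fill-adjacent (Next⇒Adjacent h next′) (middle occ) (Occupied-mono (m≤n+m t 2) occ)
    where
    middle : Occupied t i″ → ColumnFull (2 ℕ.+ t) i′
    middle (lowerOcc p) = inf-suc (suc t) i′ 1 bridged
                        & infect-corner (suc t) (Next⇒Adjacent h next) upper (inf-suc t i 2 (upperInf F)) bridged
      where bridged = infect-between-Next h t 0 next next′ (lowerInf F) p
    middle (upperOcc q) = infect-corner (suc t) (Next⇒Adjacent h next) lower (inf-suc t i 1 (lowerInf F)) bridged
                        & inf-suc (suc t) i′ 2 bridged
      where bridged = infect-between-Next h t 1 next next′ (upperInf F) q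

  module Sweep (h : Heading) (col : ℕ → ℕ) (D a : ℕ)
    (next : ∀ d → d < D → Next h (col d) (col (suc d)))
    (noGap : ∀ d → d < D → Occupied 0 (col d) ⊎ Occupied 0 (col (suc d)))
    (occ-start : Occupied 0 (col 0)) (occ-end : Occupied 0 (col D))
    (full-start : ColumnFull a (col 0)) where

    Reached : ℕ → Set
    Reached d = d ≤ D → Occupied 0 (col d) → ColumnFull (crossTime d ℕ.+ a) (col d)

    fill-across-from : ∀ d → suc (suc d) ≤ D → ColumnFull (crossTime d ℕ.+ a) (col d) →
      Occupied 0 (col (suc (suc d))) →
      ColumnFull (2 ℕ.+ (crossTime d ℕ.+ a)) (col (suc d)) ×
      ColumnFull (crossTime (suc (suc d)) ℕ.+ a) (col (suc (suc d)))
    fill-across-from d d+2≤D F occ = fill-across h (next d (ℕₚ.<-trans (ℕₚ.n<1+n d) d+2≤D)) (next (suc d) d+2≤D)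
      F (Occupied-mono z≤n occ)

    reached-pair : ∀ d → Reached d × Reached (suc d)
    reached-pair zero = (λ _ _ → full-start) , λ 1≤D occ →
      fill-adjacent (Next⇒Adjacent h (next 0 1≤D)) full-start (Occupied-mono z≤n occ)
    reached-pair (suc d) with reached-pair d
    ... | reached-d , reached-d+1 = reached-d+1 , reached-d+2
      where
      reached-d+2 : Reached (suc (suc d))
      reached-d+2 d+2≤D occ with noGap d (ℕₚ.<-trans (ℕₚ.n<1+n _) d+2≤D)
      ... | inj₁ occ-d =
        proj₂ (fill-across-from d d+2≤D (reached-d (≤-trans (n≤1+n _) (<⇒≤ d+2≤D)) occ-d) occ)
      ... | inj₂ occ-d+1 = ColumnFull-mono (ℕₚ.+-monoˡ-≤ a (crossTime-<-suc (suc d)))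
        (fill-adjacent (Next⇒Adjacent h (next (suc d) d+2≤D)) (reached-d+1 (<⇒≤ d+2≤D) occ-d+1)
           (Occupied-mono z≤n occ))

    reached : ∀ d → Reached d
    reached d = proj₁ (reached-pair d)

    later : ∀ {d} → d ≤ D → ColumnFull (crossTime d ℕ.+ a) (col d) →
      ColumnFull (crossTime D ℕ.+ a) (col d)
    later d≤D = ColumnFull-mono (ℕₚ.+-monoˡ-≤ a (crossTime-mono d≤D))

    -- A column not known to be occupied lies between two occupied ones and is filled across from the first.
    sweep : ∀ d → d ≤ D → ColumnFull (crossTime D ℕ.+ a) (col d)
    sweep d d≤D with ℕₚ.m≤n⇒m<n∨m≡n d≤D
    ... | inj₂ refl = reached d d≤D occ-end
    ... | inj₁ d<D with noGap d d<D
    ...   | inj₁ occ-d = later d≤D (reached d d≤D occ-d)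
    sweep zero d≤D | inj₁ d<D | inj₂ _ = later d≤D (reached 0 d≤D occ-start)
    sweep (suc d) d≤D | inj₁ d<D | inj₂ occ-d+2 with noGap d (ℕₚ.<-trans (ℕₚ.n<1+n d) d<D)
    ... | inj₂ occ-d+1 = later d≤D (reached (suc d) d≤D occ-d+1)
    ... | inj₁ occ-d =
      ColumnFull-mono (ℕₚ.+-monoˡ-≤ a (≤-trans (ℕₚ.m≤n+m _ 1) (crossTime-mono {suc (suc d)} d<D)))
      (proj₁ (fill-across-from d d<D (reached d (≤-trans (n≤1+n d) d≤D) occ-d) occ-d+2))

  Empty : ℕ → ℕ → Set
  Empty t i = ∀ r → inf t i r ≡ false

  empty-outside : ∀ t i → ¬ (1 ≤ i × i ≤ k) → Empty t i
  empty-outside t i ∉grid r = uninfected-outside t i r λ g → ∉grid (1≤i g , i≤k g)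

  empty-stays : ∀ t i → Empty t (suc i) → Empty t i ⊎ Empty t (suc (suc i)) → Empty (suc t) (suc i)
  empty-stays t i empty _ zero = uninfected-row0 (suc t) (suc i)
  empty-stays t i empty (inj₁ emptyLeft) (suc r) = staysUninfected t i r right (empty (suc r)) λ where
    right _ → refl
    left p → trueFalse-elim p (emptyLeft (suc r))
    up p → trueFalse-elim p (empty (suc (suc r)))
    down p → trueFalse-elim p (empty r)
  empty-stays t i empty (inj₂ emptyRight) (suc r) = staysUninfected t i r left (empty (suc r)) λ where
    left _ → refl
    right p → trueFalse-elim p (emptyRight (suc r))
    up p → trueFalse-elim p (empty (suc (suc r)))
    down p → trueFalse-elim p (empty r)

  empty-forever : ∀ {i} → (∀ t → Empty t i → Empty (suc t) i) → Empty 0 i → ∀ t → Empty t i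
  empty-forever stays empty zero = empty
  empty-forever stays empty (suc t) = stays t (empty-forever stays empty t)

  emptyFirst-stays : ∀ t → Empty t 1 → Empty (suc t) 1
  emptyFirst-stays t empty = empty-stays t 0 empty (inj₁ (empty-outside t 0 (ℕₚ.n≮0 ∘ proj₁)))

  emptyLast-stays : ∀ t → Empty t (suc (k ∸ 1)) → Empty (suc t) (suc (k ∸ 1))
  emptyLast-stays t empty = empty-stays t (k ∸ 1) empty
    (inj₂ (empty-outside t _ λ (_ , i≤k) → ℕₚ.<-irrefl refl (≤-trans i≤k (ℕₚ.m≤n+m∸n k 1))))

  emptyPair-stays : ∀ t i → Empty t (suc i) × Empty t (suc (suc i)) →
    Empty (suc t) (suc i) × Empty (suc t) (suc (suc i))
  emptyPair-stays t i (empty , empty′) =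
    empty-stays t i empty (inj₂ empty′) , empty-stays t (suc i) empty′ (inj₁ empty)

  -- Two infected sites which alone infect a 2 × 2 square: a full column or a diagonal pair.
  data Seed (t i : ℕ) : Set where
    stacked : inf t i 1 ≡ true → inf t i 2 ≡ true → Seed t i
    rising : inf t i 1 ≡ true → inf t (suc i) 2 ≡ true → Seed t i
    falling : inf t i 2 ≡ true → inf t (suc i) 1 ≡ true → Seed t i

  NoSeed : ℕ → Set
  NoSeed t = ∀ i → Seed t i → ⊥

  newlyInfected-lower : ∀ t i → NoSeed t → inf (suc t) (suc i) 1 ≡ true → inf t (suc i) 1 ≡ false →
    inf t i 1 ≡ true × inf t (suc (suc i)) 1 ≡ true × inf t (suc i) 2 ≡ false
  newlyInfected-lower t i noSeed now before = fromPair (newlyInfected⇒TwoOf t i 0 now before)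
    where
    Conclusion : Set
    Conclusion = inf t i 1 ≡ true × inf t (suc (suc i)) 1 ≡ true × inf t (suc i) 2 ≡ false
    horizontal : inf t i 1 ≡ true → inf t (suc (suc i)) 1 ≡ true → Conclusion
    horizontal p q = p , q , ¬-not λ u → noSeed (suc i) (falling u q)
    below : inf t (suc i) 0 ≡ true → ⊥
    below p = trueFalse-elim p (uninfected-row0 t (suc i))
    fromPair : TwoOf (InfectedNb t i 0) → Conclusion
    fromPair (right , left , _ , q , p) = horizontal p q
    fromPair (left , right , _ , p , q) = horizontal p q
    fromPair (down , _ , _ , p , _) = ⊥-elim (below p)
    fromPair (_ , down , _ , _ , p) = ⊥-elim (below p)
    fromPair (right , up , _ , q , u) = ⊥-elim (noSeed (suc i) (falling u q))
    fromPair (up , right , _ , u , q) = ⊥-elim (noSeed (suc i) (falling u q))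
    fromPair (left , up , _ , p , u) = ⊥-elim (noSeed i (rising p u))
    fromPair (up , left , _ , u , p) = ⊥-elim (noSeed i (rising p u))
    fromPair (right , right , x≢x , _) = ⊥-elim (x≢x refl)
    fromPair (left , left , x≢x , _) = ⊥-elim (x≢x refl)
    fromPair (up , up , x≢x , _) = ⊥-elim (x≢x refl)

  newlyInfected-upper : ∀ t i → NoSeed t → inf (suc t) (suc i) 2 ≡ true → inf t (suc i) 2 ≡ false →
    inf t i 2 ≡ true × inf t (suc (suc i)) 2 ≡ true × inf t (suc i) 1 ≡ false
  newlyInfected-upper t i noSeed now before = fromPair (newlyInfected⇒TwoOf t i 1 now before)
    where
    Conclusion : Set
    Conclusion = inf t i 2 ≡ true × inf t (suc (suc i)) 2 ≡ true × inf t (suc i) 1 ≡ false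
    horizontal : inf t i 2 ≡ true → inf t (suc (suc i)) 2 ≡ true → Conclusion
    horizontal p q = p , q , ¬-not λ d → noSeed (suc i) (rising d q)
    above : inf t (suc i) 3 ≡ true → ⊥
    above p = trueFalse-elim p (uninfected-row3 t (suc i))
    fromPair : TwoOf (InfectedNb t i 1) → Conclusion
    fromPair (right , left , _ , q , p) = horizontal p q
    fromPair (left , right , _ , p , q) = horizontal p q
    fromPair (up , _ , _ , p , _) = ⊥-elim (above p)
    fromPair (_ , up , _ , _ , p) = ⊥-elim (above p)
    fromPair (right , down , _ , q , d) = ⊥-elim (noSeed (suc i) (rising d q))
    fromPair (down , right , _ , d , q) = ⊥-elim (noSeed (suc i) (rising d q))
    fromPair (left , down , _ , p , d) = ⊥-elim (noSeed i (falling p d))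
    fromPair (down , left , _ , d , p) = ⊥-elim (noSeed i (falling p d))
    fromPair (right , right , x≢x , _) = ⊥-elim (x≢x refl)
    fromPair (left , left , x≢x , _) = ⊥-elim (x≢x refl)
    fromPair (down , down , x≢x , _) = ⊥-elim (x≢x refl)

  seedFree-persists : ∀ t → NoSeed t → NoSeed (suc t)
  seedFree-persists t noSeed zero (stacked p _) = trueFalse-elim p (uninfected-column0 (suc t) 1)
  seedFree-persists t noSeed zero (rising p _) = trueFalse-elim p (uninfected-column0 (suc t) 1)
  seedFree-persists t noSeed zero (falling p _) = trueFalse-elim p (uninfected-column0 (suc t) 2)
  seedFree-persists t noSeed (suc i) (stacked p q) =
    bool-cases (inf t (suc i) 1)
      (λ old₁ → bool-cases (inf t (suc i) 2)
        (λ old₂ → noSeed (suc i) (stacked old₁ old₂))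
        (λ new₂ → trueFalse-elim old₁ (proj₂ (proj₂ (newlyInfected-upper t i noSeed q new₂)))))
      (λ new₁ → let lower = newlyInfected-lower t i noSeed p new₁ in
        noSeed i (stacked (proj₁ lower) (proj₁ (newlyInfected-upper t i noSeed q (proj₂ (proj₂ lower))))))
  seedFree-persists t noSeed (suc i) (rising p q) =
    bool-cases (inf t (suc i) 1)
      (λ old₁ → bool-cases (inf t (suc (suc i)) 2)
        (λ old₂ → noSeed (suc i) (rising old₁ old₂))
        (λ new₂ → noSeed (suc i) (stacked old₁ (proj₁ (newlyInfected-upper t (suc i) noSeed q new₂)))))
      (λ new₁ → let rightOld = proj₁ (proj₂ (newlyInfected-lower t i noSeed p new₁)) in
        bool-cases (inf t (suc (suc i)) 2)
          (λ old₂ → noSeed (suc (suc i)) (stacked rightOld old₂))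
          (λ new₂ → trueFalse-elim rightOld (proj₂ (proj₂ (newlyInfected-upper t (suc i) noSeed q new₂)))))
  seedFree-persists t noSeed (suc i) (falling p q) =
    bool-cases (inf t (suc i) 2)
      (λ old₁ → bool-cases (inf t (suc (suc i)) 1)
        (λ old₂ → noSeed (suc i) (falling old₁ old₂))
        (λ new₂ → noSeed (suc i) (stacked (proj₁ (newlyInfected-lower t (suc i) noSeed q new₂)) old₁)))
      (λ new₁ → let rightOld = proj₁ (proj₂ (newlyInfected-upper t i noSeed p new₁)) in
        bool-cases (inf t (suc (suc i)) 1)
          (λ old₂ → noSeed (suc (suc i)) (stacked old₂ rightOld))
          (λ new₂ → trueFalse-elim rightOld (proj₂ (proj₂ (newlyInfected-lower t (suc i) noSeed q new₂)))))

  occupied-or-empty : ∀ t i → Occupied t i ⊎ Empty t i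
  occupied-or-empty t i = bool-cases (inf t i 1) (inj₁ ∘ lowerOcc) λ lowerFree →
    bool-cases (inf t i 2) (inj₁ ∘ upperOcc) λ upperFree → inj₂ λ where
      zero → uninfected-row0 t i
      (suc zero) → lowerFree
      (suc (suc zero)) → upperFree
      (suc (suc (suc r))) → uninfected-outside t i (3 ℕ.+ r) ¬InGrid-row≥3

  maxTime : ℕ
  maxTime = crossTime (k ∸ 1)

  module FromFullColumns (occ-first : Occupied 0 1) (occ-last : Occupied 0 k)
    (noGap : ∀ i → 1 ≤ i → suc i ≤ k → Occupied 0 i ⊎ Occupied 0 (suc i)) where

    sweepRight : ∀ c a → 1 ≤ c → c ≤ k → ColumnFull a c → Occupied 0 c →
      ∀ i → c ≤ i → i ≤ k → ColumnFull (crossTime (k ∸ c) ℕ.+ a) i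
    sweepRight c a 1≤c c≤k full occ i c≤i i≤k =
      subst (ColumnFull _) (ℕₚ.m+[n∸m]≡n c≤i) (S.sweep (i ∸ c) (ℕₚ.∸-monoˡ-≤ c i≤k))
      where
      next : ∀ d → d < k ∸ c → Next rightward (c ℕ.+ d) (c ℕ.+ suc d)
      next d _ = ℕₚ.+-suc c d
      noGap′ : ∀ d → d < k ∸ c → Occupied 0 (c ℕ.+ d) ⊎ Occupied 0 (c ℕ.+ suc d)
      noGap′ d d<k∸c rewrite ℕₚ.+-suc c d = noGap (c ℕ.+ d) (≤-trans 1≤c (ℕₚ.m≤m+n c d))
        (subst (_≤ k) (ℕₚ.+-suc c d)
          (≤-trans (ℕₚ.+-monoʳ-≤ c d<k∸c) (≤-reflexive (ℕₚ.m+[n∸m]≡n c≤k))))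
      module S = Sweep rightward (c ℕ.+_) (k ∸ c) a next noGap′
        (subst (Occupied 0) (sym (ℕₚ.+-identityʳ c)) occ)
        (subst (Occupied 0) (sym (ℕₚ.m+[n∸m]≡n c≤k)) occ-last)
        (subst (ColumnFull a) (sym (ℕₚ.+-identityʳ c)) full)

    sweepLeft : ∀ c a → suc c ≤ k → ColumnFull a (suc c) → Occupied 0 (suc c) →
      ∀ i → 1 ≤ i → i ≤ suc c → ColumnFull (crossTime c ℕ.+ a) i
    sweepLeft c a c<k full occ i 1≤i i≤c+1 =
      subst (ColumnFull _) (ℕₚ.m∸[m∸n]≡n i≤c+1)
        (S.sweep (suc c ∸ i) (ℕₚ.∸-monoʳ-≤ (suc c) 1≤i))
      where
      next : ∀ d → d < c → Next leftward (suc c ∸ d) (suc c ∸ suc d)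
      next d d<c = ℕₚ.+-∸-assoc 1 (<⇒≤ d<c)
      noGap′ : ∀ d → d < c → Occupied 0 (suc c ∸ d) ⊎ Occupied 0 (suc c ∸ suc d)
      noGap′ d d<c rewrite next d d<c
        with noGap (c ∸ d) (ℕₚ.m<n⇒0<n∸m d<c) (≤-trans (s≤s (ℕₚ.m∸n≤m c d)) c<k)
      ... | inj₁ occ-left = inj₂ occ-left
      ... | inj₂ occ-right = inj₁ occ-right
      module S = Sweep leftward (suc c ∸_) c a next noGap′ occ
        (subst (Occupied 0) (sym (ℕₚ.m+n∸n≡m 1 c)) occ-first) full

    within : ∀ {d i} → d ≤ k ∸ 1 → ColumnFull (crossTime d ℕ.+ 0) i → ColumnFull maxTime i
    within d≤ = ColumnFull-mono (≤-trans (≤-reflexive (ℕₚ.+-identityʳ _)) (crossTime-mono d≤))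

    within-suc : ∀ {d i} → suc d ≤ k ∸ 1 → ColumnFull (crossTime d ℕ.+ 1) i → ColumnFull maxTime i
    within-suc {d} d<  = ColumnFull-mono (≤-trans (crossTime-+1 d) (crossTime-mono d<))

    allFull-fromColumn : ∀ c → ColumnFull 0 c → ∀ i → 1 ≤ i → i ≤ k → ColumnFull maxTime i
    allFull-fromColumn c full i 1≤i i≤k with inf⇒InGrid 0 c 1 (lowerInf full)
    allFull-fromColumn (suc c) full i 1≤i i≤k | inGrid⁺ _ c<k _ _ with ℕₚ.≤-total (suc c) i
    ... | inj₁ c<i = within (ℕₚ.∸-monoʳ-≤ k (s≤s z≤n))
      (sweepRight (suc c) 0 (s≤s z≤n) c<k full (lowerOcc (lowerInf full)) i c<i i≤k)
    ... | inj₂ i≤c = within (ℕₚ.∸-monoˡ-≤ 1 c<k) (sweepLeft c 0 c<k full (lowerOcc (lowerInf full)) i 1≤i i≤c)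

    allFull-fromDiagonal : ∀ c → ColumnFull 1 c → ColumnFull 1 (suc c) → Occupied 0 c → Occupied 0 (suc c) →
      ∀ i → 1 ≤ i → i ≤ k → ColumnFull maxTime i
    allFull-fromDiagonal c full full′ occ occ′ i 1≤i i≤k
      with inf⇒InGrid 1 c 1 (lowerInf full) | inf⇒InGrid 1 (suc c) 1 (lowerInf full′)
    allFull-fromDiagonal (suc c) full full′ occ occ′ i 1≤i i≤k | _ | inGrid⁺ _ c+1<k _ _
      with ℕₚ.≤-<-connex i (suc c)
    ... | inj₁ i≤c = within-suc (ℕₚ.∸-monoˡ-≤ 1 c+1<k) (sweepLeft c 1 (<⇒≤ c+1<k) full occ i 1≤i i≤c)
    ... | inj₂ c<i = within-suc (subst (_≤ k ∸ 1) (ℕₚ.+-∸-assoc 1 c+1<k) (ℕₚ.∸-monoʳ-≤ k (s≤s z≤n)))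
      (sweepRight (suc (suc c)) 1 (s≤s z≤n) c+1<k full′ occ′ i c<i i≤k)

    allFull-fromSeed : ∀ c → Seed 0 c → ∀ i → 1 ≤ i → i ≤ k → ColumnFull maxTime i
    allFull-fromSeed c (stacked p q) = allFull-fromColumn c (p & q)
    allFull-fromSeed c (rising p q) = allFull-fromDiagonal c
      (inf-suc 0 c 1 p & infect-corner 0 (toLeft c) upper q p)
      (infect-corner 0 (toRight c) lower p q & inf-suc 0 (suc c) 2 q) (lowerOcc p) (upperOcc q)
    allFull-fromSeed c (falling p q) = allFull-fromDiagonal c
      (infect-corner 0 (toLeft c) lower q p & inf-suc 0 c 2 p)
      (inf-suc 0 (suc c) 1 q & infect-corner 0 (toRight c) upper p q) (upperOcc p) (lowerOcc q)

  ColumnFull⇒inf : ∀ {t i r} → InGrid i r → ColumnFull t i → inf t i r ≡ true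
  ColumnFull⇒inf {r = zero} g _ = ⊥-elim (¬InGrid-row0 g)
  ColumnFull⇒inf {r = suc zero} _ full = lowerInf full
  ColumnFull⇒inf {r = suc (suc zero)} _ full = upperInf full
  ColumnFull⇒inf {r = suc (suc (suc r))} g _ = ⊥-elim (¬InGrid-row≥3 g)

  AllInfected : ℕ → Set
  AllInfected t = ∀ i r → InGrid i r → inf t i r ≡ true

  module UpperBound (1≤k : 1 ≤ k) (T : ℕ) (allT : AllInfected T) where

    nonEmpty : ∀ {i} → 1 ≤ i → i ≤ k → Empty T i → ⊥
    nonEmpty {i} 1≤i i≤k empty = trueFalse-elim (allT i 1 (inGrid⁺ 1≤i i≤k ≤-refl (s≤s z≤n))) (empty 1)

    occupied-initially : ∀ i → 1 ≤ i → i ≤ k → (∀ t → Empty t i → Empty (suc t) i) → Occupied 0 i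
    occupied-initially i 1≤i i≤k stays with occupied-or-empty 0 i
    ... | inj₁ occ = occ
    ... | inj₂ empty = ⊥-elim (nonEmpty 1≤i i≤k (empty-forever stays empty T))

    occ-first : Occupied 0 1
    occ-first = occupied-initially 1 ≤-refl 1≤k emptyFirst-stays

    occ-last : Occupied 0 k
    occ-last = subst (Occupied 0) (ℕₚ.m+[n∸m]≡n 1≤k)
      (occupied-initially (suc (k ∸ 1)) (s≤s z≤n) (≤-reflexive (ℕₚ.m+[n∸m]≡n 1≤k)) emptyLast-stays)

    noGap : ∀ i → 1 ≤ i → suc i ≤ k → Occupied 0 i ⊎ Occupied 0 (suc i)
    noGap (suc i) _ i+1<k with occupied-or-empty 0 (suc i) | occupied-or-empty 0 (suc (suc i))
    ... | inj₁ occ | _ = inj₁ occ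
    ... | inj₂ _ | inj₁ occ = inj₂ occ
    ... | inj₂ empty | inj₂ empty′ = ⊥-elim (nonEmpty (s≤s z≤n) (<⇒≤ i+1<k) (proj₁ (both T)))
      where
      both : ∀ t → Empty t (suc i) × Empty t (suc (suc i))
      both zero = empty , empty′
      both (suc t) = emptyPair-stays t i (both t)

    seed-initially : NoSeed 0 → ⊥
    seed-initially noSeed = seedFree T 1 (stacked (allT 1 1 (inGrid⁺ ≤-refl 1≤k ≤-refl (s≤s z≤n)))
                                                   (allT 1 2 (inGrid⁺ ≤-refl 1≤k (s≤s z≤n) ≤-refl)))
      where
      seedFree : ∀ t → NoSeed t
      seedFree zero = noSeed
      seedFree (suc t) = seedFree-persists t (seedFree t)

    open FromFullColumns occ-first occ-last noGap

    allInfected : AllInfected maxTime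
    allInfected i r g = bool-cases (inf maxTime i r) (λ infected → infected) λ uninfected →
      ⊥-elim (seed-initially λ c seed → trueFalse-elim
        (ColumnFull⇒inf g (allFull-fromSeed c seed i (1≤i g) (i≤k g))) uninfected)

  AllInfected⇒Full : ∀ t → AllInfected t → Full (grid k 2) A t
  AllInfected⇒Full t all (+ i , + r) p = all i r (inGrid⇒InGrid i r p)
  AllInfected⇒Full t all (+ i , -[1+ n ]) p
    with ∧-conicalʳ (i ℕ.+ 1 ≤ᵇ suc k) _ (∧-conicalʳ (1 ≤ᵇ i) _ p)
  ... | ()
  AllInfected⇒Full t all (-[1+ n ] , _) ()

  Full⇒AllInfected : ∀ t → Full (grid k 2) A t → AllInfected t
  Full⇒AllInfected t full i r g = full (+ i , + r) (InGrid⇒inGrid g)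

  percolationTime≤maxTime : 1 ≤ k → ∀ T → SpansInTime (grid k 2) A T → T ≤ maxTime
  percolationTime≤maxTime 1≤k T (fullT , notBefore) with T ℕ.≤? maxTime
  ... | yes T≤maxTime = T≤maxTime
  ... | no T≰maxTime = ⊥-elim (notBefore _ (ℕₚ.≰⇒> T≰maxTime)
          (AllInfected⇒Full maxTime (UpperBound.allInfected 1≤k T (Full⇒AllInfected T fullT))))

  Slow : (ℕ → ℕ → ℕ) → ℕ → ℕ → Set
  Slow δ i r = Σ Dir λ d₀ → ∀ d → InGrid (nbCol d i) (nbRow d r) →
    d ≡ d₀ ⊎ δ (suc i) (suc r) ≤ suc (δ (nbCol d i) (nbRow d r))

  vertical : ℕ → Dir
  vertical zero = up
  vertical (suc _) = down

  slow-intro : ∀ δ i r → r ≤ 1 → (d₀ : Dir) →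
    right ≡ d₀ ⊎ (InGrid (suc (suc i)) (suc r) → δ (suc i) (suc r) ≤ suc (δ (suc (suc i)) (suc r))) →
    left ≡ d₀ ⊎ (InGrid i (suc r) → δ (suc i) (suc r) ≤ suc (δ i (suc r))) →
    vertical r ≡ d₀ ⊎ δ (suc i) (suc r) ≤ suc (δ (suc i) (nbRow (vertical r) r)) →
    Slow δ i r
  slow-intro δ i zero _ d₀ viaRight viaLeft viaVertical = d₀ , λ where
    right g → map₂ (λ bound → bound g) viaRight
    left g → map₂ (λ bound → bound g) viaLeft
    up _ → viaVertical
    down g → ⊥-elim (¬InGrid-row0 g)
  slow-intro δ i (suc zero) _ d₀ viaRight viaLeft viaVertical = d₀ , λ where
    right g → map₂ (λ bound → bound g) viaRight
    left g → map₂ (λ bound → bound g) viaLeft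
    up g → ⊥-elim (¬InGrid-row≥3 g)
    down _ → viaVertical
  slow-intro δ i (suc (suc r)) (s≤s ())

  module DelayBound (δ : ℕ → ℕ → ℕ) (initial : ∀ i r → inf 0 i r ≡ true → δ i r ≡ 0)
    (slow : ∀ i r → InGrid (suc i) (suc r) → Slow δ i r) where

    -- A newly infected site has two infected neighbours, at most one of them exceptional.
    delay≤time : ∀ t i r → inf t i r ≡ true → δ i r ≤ t
    delay≤time zero i r p = ≤-reflexive (initial i r p)
    delay≤time (suc t) i r p = bool-cases (inf t i r) (ℕₚ.m≤n⇒m≤1+n ∘ delay≤time t i r) (newly i r p)
      where
      viaNeighbour : ∀ i r d → InfectedNb t i r d → δ (suc i) (suc r) ≤ suc (δ (nbCol d i) (nbRow d r)) →
        δ (suc i) (suc r) ≤ suc t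
      viaNeighbour i r d infected bound = ≤-trans bound (s≤s (delay≤time t _ _ infected))
      newly : ∀ i r → inf (suc t) i r ≡ true → inf t i r ≡ false → δ i r ≤ suc t
      newly zero r now _ = trueFalse-elim now (uninfected-column0 (suc t) r)
      newly (suc i) zero now _ = trueFalse-elim now (uninfected-row0 (suc t) (suc i))
      newly (suc i) (suc r) now before with newlyInfected⇒TwoOf t i r now before
      ... | x , y , x≢y , px , py
        with slow i r (inf⇒InGrid (suc t) (suc i) (suc r) now)
      ... | d₀ , bounds with bounds x (inf⇒InGrid t _ _ px) | bounds y (inf⇒InGrid t _ _ py)
      ...   | inj₂ bound | _ = viaNeighbour i r x px bound
      ...   | inj₁ _ | inj₂ bound = viaNeighbour i r y py bound
      ...   | inj₁ x≡d₀ | inj₁ y≡d₀ = ⊥-elim (x≢y (trans x≡d₀ (sym y≡d₀)))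

odd : ℕ → Bool
odd zero = false
odd (suc zero) = true
odd (suc (suc n)) = odd n

double : ℕ → ℕ
double zero = zero
double (suc j) = suc (suc (double j))

odd-double : ∀ j → odd (double j) ≡ false
odd-double zero = refl
odd-double (suc j) = odd-double j

odd-suc-double : ∀ j → odd (suc (double j)) ≡ true
odd-suc-double zero = refl
odd-suc-double (suc j) = odd-suc-double j

data Parity : ℕ → Set where
  even : ∀ j → Parity (double j)
  odd+ : ∀ j → Parity (suc (double j))

parity : ∀ n → Parity n
parity zero = even 0
parity (suc zero) = odd+ 0
parity (suc (suc n)) with parity n
... | even j = even (suc j)
... | odd+ j = odd+ (suc j)

crossTime-suc-double : ∀ j → crossTime (suc (double j)) ≡ suc (crossTime (double j))
crossTime-suc-double zero = refl
crossTime-suc-double (suc j) = cong (3 ℕ.+_) (crossTime-suc-double j)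

data Row : ℕ → Set where
  row1 : Row 1
  row2 : Row 2

flipRow : ℕ → ℕ
flipRow (suc zero) = 2
flipRow _ = 1

flipRow-≡ᵇ : ∀ {r s} → Row r → Row s → (flipRow r ≡ᵇ s) ≡ not (r ≡ᵇ s)
flipRow-≡ᵇ row1 row1 = refl
flipRow-≡ᵇ row1 row2 = refl
flipRow-≡ᵇ row2 row1 = refl
flipRow-≡ᵇ row2 row2 = refl

≡ᵇ-flipRow : ∀ {r s} → Row r → Row s → (r ≡ᵇ flipRow s) ≡ not (r ≡ᵇ s)
≡ᵇ-flipRow row1 row1 = refl
≡ᵇ-flipRow row1 row2 = refl
≡ᵇ-flipRow row2 row1 = refl
≡ᵇ-flipRow row2 row2 = refl

-- Here and in Extremal, columns are counted from 0: column c is column 1 + c of the grid.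
seedRow : ℕ → ℕ
seedRow zero = 2
seedRow (suc zero) = 2
seedRow (suc (suc c)) = flipRow (seedRow c)

seedRow-Row : ∀ c → Row (seedRow c)
seedRow-Row zero = row2
seedRow-Row (suc zero) = row2
seedRow-Row (suc (suc c)) with seedRow c | seedRow-Row c
... | .1 | row1 = row2
... | .2 | row2 = row1

seedRow-suc-double : ∀ j → seedRow (suc (double j)) ≡ seedRow (double j)
seedRow-suc-double zero = refl
seedRow-suc-double (suc j) = cong flipRow (seedRow-suc-double j)

onSeedRow : ℕ → ℕ → Bool
onSeedRow c r = r ≡ᵇ seedRow c

onSeedRow-seedRow : ∀ c → onSeedRow c (seedRow c) ≡ true
onSeedRow-seedRow c with seedRow c | seedRow-Row c
... | .1 | row1 = refl
... | .2 | row2 = refl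

onSeedRow-flipRow : ∀ c {r} → Row r → onSeedRow c (flipRow r) ≡ not (onSeedRow c r)
onSeedRow-flipRow c r = flipRow-≡ᵇ r (seedRow-Row c)

onSeedRow-suc-double : ∀ j r → onSeedRow (suc (double j)) r ≡ onSeedRow (double j) r
onSeedRow-suc-double j r = cong (r ≡ᵇ_) (seedRow-suc-double j)

onSeedRow-nextBlock : ∀ j {r} → Row r → onSeedRow (double (suc j)) r ≡ not (onSeedRow (suc (double j)) r)
onSeedRow-nextBlock j {r} row = begin
  (r ≡ᵇ flipRow (seedRow (double j)))   ≡⟨ ≡ᵇ-flipRow row (seedRow-Row (double j)) ⟩
  not (onSeedRow (double j) r)          ≡⟨ cong not (sym (onSeedRow-suc-double j r)) ⟩
  not (onSeedRow (suc (double j)) r)    ∎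
  where open ≡-Reasoning

module Extremal (k : ℕ) where

  isLast : ℕ → Bool
  isLast c = suc c ≡ᵇ k

  seeded : ℕ → ℕ → Bool
  seeded c r = onSeedRow c r ∧ (not (odd c) ∨ isLast c)

  extremalSet : SiteSet
  extremalSet (+ zero , _) = false
  extremalSet (+ suc c , + r) = (c ≡ᵇ 0) ∨ seeded c r
  extremalSet (+ suc c , -[1+ _ ]) = false
  extremalSet (-[1+ _ ] , _) = false

  -- Indexed by grid columns, as the potential of DelayBound.
  delay : ℕ → ℕ → ℕ
  delay zero r = 0
  delay (suc c) r = if seeded c r then 0 else (if odd c ∧ onSeedRow c r then suc (crossTime c) else crossTime c)

  delay-even : ∀ j r → onSeedRow (double j) r ≡ false → delay (suc (double j)) r ≡ crossTime (double j)
  delay-even j r off rewrite off | odd-double j = refl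

  delay-odd : ∀ j r → onSeedRow (suc (double j)) r ≡ false →
    delay (suc (suc (double j))) r ≡ crossTime (suc (double j))
  delay-odd j r off rewrite off | odd-suc-double j = refl

  delay-odd-seedRow : ∀ j r → onSeedRow (suc (double j)) r ≡ true → isLast (suc (double j)) ≡ false →
    delay (suc (suc (double j))) r ≡ suc (crossTime (suc (double j)))
  delay-odd-seedRow j r on notLast rewrite on | odd-suc-double j | notLast = refl

  open TwoRowGrid k extremalSet

  seeded-even : ∀ j r → seeded (double j) r ≡ onSeedRow (double j) r
  seeded-even j r rewrite odd-double j = ∧-identityʳ _

  seeded-odd : ∀ j r → seeded (suc (double j)) r ≡ onSeedRow (suc (double j)) r ∧ isLast (suc (double j))
  seeded-odd j r rewrite odd-suc-double j = refl

  delay-seeded : ∀ c r → seeded c r ≡ true → delay (suc c) r ≡ 0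
  delay-seeded c r s rewrite s = refl

  delay-column1 : ∀ r → delay 1 r ≡ 0
  delay-column1 r with seeded 0 r
  ... | true = refl
  ... | false = refl

  isLast⇒≡ : ∀ {c} → isLast c ≡ true → suc c ≡ k
  isLast⇒≡ {c} last = ℕₚ.≡ᵇ⇒≡ (suc c) k (Equivalence.from T-≡ last)

  isLast-≡ : ∀ {c} → suc c ≡ k → isLast c ≡ true
  isLast-≡ {c} c+1≡k = Equivalence.to T-≡ (ℕₚ.≡⇒≡ᵇ (suc c) k c+1≡k)

  isLast-< : ∀ {c} → suc (suc c) ≤ k → isLast c ≡ false
  isLast-< c+1<k = ¬-not λ last → ℕₚ.<-irrefl (isLast⇒≡ last) c+1<k

  rowOf : ∀ {r} → r ≤ 1 → Row (suc r)
  rowOf z≤n = row1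
  rowOf (s≤s z≤n) = row2

  vertical-flipRow : ∀ {r} → r ≤ 1 → nbRow (vertical r) r ≡ flipRow (suc r)
  vertical-flipRow z≤n = refl
  vertical-flipRow (s≤s z≤n) = refl

  ≤-suc-subst : ∀ {s n x y} → s ≡ x → n ≡ y → x ≤ suc y → s ≤ suc n
  ≤-suc-subst refl refl x≤y = x≤y

  slow-delay0 : ∀ i r → delay (suc i) (suc r) ≡ 0 → Slow delay i r
  slow-delay0 i r noDelay = right , λ d _ →
    inj₂ (subst (_≤ suc (delay (nbCol d i) (nbRow d r))) (sym noDelay) z≤n)

  slow-even : ∀ j r → r ≤ 1 → suc (double (suc j)) ≤ k → onSeedRow (double (suc j)) (suc r) ≡ false →
    Slow delay (double (suc j)) r
  slow-even j r r≤1 c<k off = slow-intro delay (double (suc j)) r r≤1 (vertical r)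
    (inj₂ λ _ → ≤-suc-subst (delay-even (suc j) (suc r) off)
      (delay-odd (suc j) (suc r) (trans (onSeedRow-suc-double (suc j) (suc r)) off))
      (≤-trans (<⇒≤ (crossTime-<-suc (double (suc j)))) (n≤1+n _)))
    (inj₂ λ _ → ≤-suc-subst (delay-even (suc j) (suc r) off)
      (delay-odd-seedRow j (suc r) (not-swap (trans (sym off) (onSeedRow-nextBlock j (rowOf r≤1)))) (isLast-< c<k))
      (≤-reflexive (cong (λ x → suc (suc x)) (sym (crossTime-suc-double j)))))
    (inj₁ refl)

  slow-odd-seedRow : ∀ j r → r ≤ 1 → onSeedRow (suc (double j)) (suc r) ≡ true →
    isLast (suc (double j)) ≡ false → Slow delay (suc (double j)) r
  slow-odd-seedRow j r r≤1 on notLast = slow-intro delay (suc (double j)) r r≤1 left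
    (inj₂ λ _ → ≤-suc-subst (delay-odd-seedRow j (suc r) on notLast)
      (delay-even (suc j) (suc r) (trans (onSeedRow-nextBlock j (rowOf r≤1)) (cong not on)))
      (s≤s (subst (_≤ 3 ℕ.+ crossTime (double j)) (sym (crossTime-suc-double j)) (m≤n+m _ 2))))
    (inj₁ refl)
    (inj₂ (≤-suc-subst (delay-odd-seedRow j (suc r) on notLast)
      (subst (λ r′ → delay (suc (suc (double j))) r′ ≡ crossTime (suc (double j))) (sym (vertical-flipRow r≤1))
        (delay-odd j (flipRow (suc r))
          (trans (onSeedRow-flipRow (suc (double j)) (rowOf r≤1)) (cong not on))))
      ≤-refl))

  slow-odd-offSeedRow : ∀ j r → r ≤ 1 → onSeedRow (suc (double j)) (suc r) ≡ false →
    Slow delay (suc (double j)) r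
  slow-odd-offSeedRow j r r≤1 off = bool-cases (isLast (suc (double j)))
    (λ last → slow-intro delay (suc (double j)) r r≤1 (vertical r)
       (inj₂ λ g → ⊥-elim (ℕₚ.<-irrefl (isLast⇒≡ last) (i≤k g)))
       viaLeft (inj₁ refl))
    (λ notLast → slow-intro delay (suc (double j)) r r≤1 right (inj₁ refl) viaLeft
       (inj₂ (≤-suc-subst (delay-odd j (suc r) off)
         (subst (λ r′ → delay (suc (suc (double j))) r′ ≡ suc (crossTime (suc (double j))))
           (sym (vertical-flipRow r≤1))
           (delay-odd-seedRow j (flipRow (suc r))
             (trans (onSeedRow-flipRow (suc (double j)) (rowOf r≤1)) (cong not off)) notLast))
         (m≤n+m _ 2))))
    where
    viaLeft : ∀ {d₀} → left ≡ d₀ ⊎ (InGrid (suc (double j)) (suc r) →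
      delay (suc (suc (double j))) (suc r) ≤ suc (delay (suc (double j)) (suc r)))
    viaLeft = inj₂ λ _ → ≤-suc-subst (delay-odd j (suc r) off)
      (delay-even j (suc r) (trans (sym (onSeedRow-suc-double j (suc r))) off))
      (≤-reflexive (crossTime-suc-double j))

  slow : ∀ i r → InGrid (suc i) (suc r) → Slow delay i r
  slow c r g = bool-cases (seeded c (suc r)) (slow-delay0 c r ∘ delay-seeded c (suc r)) (byParity (parity c) g)
    where
    r≤1 : r ≤ 1
    r≤1 = ℕₚ.≤-pred (r≤2 g)
    byParity : ∀ {c} → Parity c → InGrid (suc c) (suc r) → seeded c (suc r) ≡ false → Slow delay c r
    byParity (even zero) _ _ = slow-delay0 0 r (delay-column1 (suc r))
    byParity (even (suc j)) g unseeded =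
      slow-even j r r≤1 (i≤k g) (trans (sym (seeded-even (suc j) (suc r))) unseeded)
    byParity (odd+ j) _ unseeded = bool-cases (onSeedRow (suc (double j)) (suc r))
      (λ on → slow-odd-seedRow j r r≤1 on
        (trans (sym (trans (seeded-odd j (suc r)) (cong (_∧ isLast (suc (double j))) on))) unseeded))
      (slow-odd-offSeedRow j r r≤1)

  initial : ∀ i r → inf 0 i r ≡ true → delay i r ≡ 0
  initial i r p = fromSet i (∧-conicalʳ (inGrid (+ i , + r)) _ p)
    where
    fromSet : ∀ i → extremalSet (+ i , + r) ≡ true → delay i r ≡ 0
    fromSet zero ()
    fromSet (suc zero) _ = delay-column1 r
    fromSet (suc (suc c)) s = delay-seeded (suc c) r s

  open DelayBound delay initial slow

  initially-infected : ∀ {c r} → InGrid (suc c) r → extremalSet (+ suc c , + r) ≡ true →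
    inf 0 (suc c) r ≡ true
  initially-infected g s = cong₂ _∧_ (InGrid⇒inGrid g) s

  seeded⇒extremal : ∀ c r → seeded c r ≡ true → extremalSet (+ suc c , + r) ≡ true
  seeded⇒extremal c r s = trans (cong ((c ≡ᵇ 0) ∨_) s) (∨-zeroʳ _)

  occupied-seeded : ∀ c {r} → Row r → suc c ≤ k → seeded c r ≡ true → Occupied 0 (suc c)
  occupied-seeded c row1 c<k s = lowerOcc (initially-infected (inGrid⁺ (s≤s z≤n) c<k ≤-refl (s≤s z≤n)) (seeded⇒extremal c 1 s))
  occupied-seeded c row2 c<k s = upperOcc (initially-infected (inGrid⁺ (s≤s z≤n) c<k (s≤s z≤n) ≤-refl) (seeded⇒extremal c 2 s))

  occupied-even : ∀ j → suc (double j) ≤ k → Occupied 0 (suc (double j))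
  occupied-even j c<k = occupied-seeded (double j) (seedRow-Row (double j)) c<k
    (trans (seeded-even j (seedRow (double j))) (onSeedRow-seedRow (double j)))

  module _ (1≤k : 1 ≤ k) where

    lastColumn : ℕ
    lastColumn = k ∸ 1

    suc-lastColumn : suc lastColumn ≡ k
    suc-lastColumn = ℕₚ.m+[n∸m]≡n 1≤k

    occ-first : Occupied 0 1
    occ-first = occupied-even 0 1≤k

    occ-last : Occupied 0 k
    occ-last = subst (Occupied 0) suc-lastColumn (byParity (parity lastColumn) suc-lastColumn)
      where
      byParity : ∀ {c} → Parity c → suc c ≡ k → Occupied 0 (suc c)
      byParity (even j) c+1≡k = occupied-even j (≤-reflexive c+1≡k)
      byParity (odd+ j) c+1≡k =
        occupied-seeded (suc (double j)) (seedRow-Row (suc (double j))) (≤-reflexive c+1≡k)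
          (trans (seeded-odd j (seedRow (suc (double j))))
            (cong₂ _∧_ (onSeedRow-seedRow (suc (double j))) (isLast-≡ c+1≡k)))

    noGap : ∀ i → 1 ≤ i → suc i ≤ k → Occupied 0 i ⊎ Occupied 0 (suc i)
    noGap (suc c) _ c+1<k with parity c
    ... | even j = inj₁ (occupied-even j (<⇒≤ c+1<k))
    ... | odd+ j = inj₂ (occupied-even (suc j) c+1<k)

    allInfected : AllInfected maxTime
    allInfected i r g = ColumnFull⇒inf g (allFull-fromColumn 1 firstFull i (1≤i g) (i≤k g))
      where
      open FromFullColumns occ-first occ-last noGap
      firstFull : ColumnFull 0 1
      firstFull = initially-infected (inGrid⁺ ≤-refl 1≤k ≤-refl (s≤s z≤n)) refl
                & initially-infected (inGrid⁺ ≤-refl 1≤k (s≤s z≤n) ≤-refl) refl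

    cornerRow : ℕ
    cornerRow = flipRow (seedRow lastColumn)

    corner-InGrid : InGrid (suc lastColumn) cornerRow
    corner-InGrid with seedRow lastColumn | seedRow-Row lastColumn
    ... | .1 | row1 = inGrid⁺ (s≤s z≤n) (≤-reflexive suc-lastColumn) (s≤s z≤n) ≤-refl
    ... | .2 | row2 = inGrid⁺ (s≤s z≤n) (≤-reflexive suc-lastColumn) ≤-refl (s≤s z≤n)

    corner-delay : delay (suc lastColumn) cornerRow ≡ maxTime
    corner-delay = byParity (parity lastColumn)
      where
      offSeedRow : ∀ c → onSeedRow c (flipRow (seedRow c)) ≡ false
      offSeedRow c = trans (onSeedRow-flipRow c (seedRow-Row c)) (cong not (onSeedRow-seedRow c))
      byParity : ∀ {c} → Parity c → delay (suc c) (flipRow (seedRow c)) ≡ crossTime c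
      byParity (even j) = delay-even j (flipRow (seedRow (double j))) (offSeedRow (double j))
      byParity (odd+ j) = delay-odd j (flipRow (seedRow (suc (double j)))) (offSeedRow (suc (double j)))

    corner-late : ∀ t → inf t (suc lastColumn) cornerRow ≡ true → maxTime ≤ t
    corner-late t p = subst (_≤ t) corner-delay (delay≤time t _ _ p)

    spans : SpansInTime (grid k 2) extremalSet maxTime
    spans = AllInfected⇒Full maxTime allInfected , λ t t<maxTime full →
      ℕₚ.<⇒≱ t<maxTime (corner-late t (Full⇒AllInfected t full _ _ corner-InGrid))

    cornerSite : Site
    cornerSite = + suc lastColumn , + cornerRow

    cornerSite-Corner : Corner (grid k 2) cornerSite
    cornerSite-Corner with seedRow lastColumn | seedRow-Row lastColumn
    ... | .1 | row1 = inj₂ (inj₂ (inj₂ refl))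
    ... | .2 | row2 = inj₂ (inj₁ refl)

    cornerSite-last : LastInf (grid k 2) extremalSet cornerSite
    cornerSite-last = maxTime , spans , allInfected _ _ corner-InGrid ,
      λ t t<maxTime → ¬-not λ p → ℕₚ.<⇒≱ t<maxTime (corner-late t p)

    isM : IsM k 2 maxTime
    isM = (extremalSet , spans) , λ A T spansA → TwoRowGrid.percolationTime≤maxTime k A 1≤k T spansA

    -- The chain consists of [k] × [2] alone, which condition (a) allows since one side has length 2.
    perfect : Perfect k 2 extremalSet
    perfect = 0 , (λ _ → grid k 2) , (refl , refl) , (1≤k , s≤s z≤n) , inj₂ (inj₁ ≤-refl) ,
      (λ ()) , (λ _ ()) ,
      λ _ _ → (maxTime , isM , spans) , λ _ _ → cornerSite , cornerSite-Corner , cornerSite-last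

lemma4 : (k : ℕ) → 1 ≤ k →
    IsM k 2 ((3 * (k ∸ 1)) / 2) ×
    (Σ SiteSet λ A → Perfect k 2 A × SpansInTime (grid k 2) A ((3 * (k ∸ 1)) / 2))
lemma4 k 1≤k = subst (λ m → IsM k 2 m × (Σ SiteSet λ A → Perfect k 2 A × SpansInTime (grid k 2) A m))
  (crossTime≡⌊3d/2⌋ (k ∸ 1)) (isM 1≤k , extremalSet , perfect 1≤k , spans 1≤k)
  where open Extremal k
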